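{- The set $\mathcal{R}_r$ of all quasi-Riordan arrays $[g,f]$ (with $g\in\mathcal{F}_0$, $g(0)=1$, $f\in\mathcal{F}_1$) is a group under ordinary matrix multiplication.
   Context: $\mathbb{K}$ is $\mathbb{R}$ or $\mathbb{C}$; $\mathcal{F}_r$ denotes the set of formal power series in $\mathbb{K}[[t]]$ of order $r$. For $g\in\mathcal{F}_0$ with $g(0)=1$ and $f\in\mathcal{F}_1$, the quasi-Riordan array $[g,f]$ is the infinite lower triangular matrix whose $0$th column has generating function $g$ and whose $j$th column, for $j\ge1$, has generating function $t^{j-1}f$, i.e. $[g,f]=(g,f,tf,t^2f,\dots)$. -}

module Defs where

open import Level using (Level; _⊔_) renaming (suc to lsuc)
open import Data.Nat using (ℕ; zero; suc; _≤_; _∸_)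
import Data.Nat
open import Data.Nat.Properties using (_≤?_)
open import Data.Product using (Σ; _×_; _,_; ∃)
open import Relation.Nullary using (¬_; yes; no)
open import Algebra.Bundles using (CommutativeRing)

record Field (c ℓ : Level) : Set (lsuc (c ⊔ ℓ)) where
  field
    commutativeRing : CommutativeRing c ℓ
  open CommutativeRing commutativeRing public
  field
    1≉0     : ¬ (1# ≈ 0#)
    inverse : ∀ x → ¬ (x ≈ 0#) → Σ Carrier λ y → (x * y) ≈ 1#

module QuasiRiordan {c ℓ : Level} (K : Field c ℓ) where
  open Field K

  Series : Set c
  Series = ℕ → Carrier

  -- infinite matrices, indexed (row, column)
  Matrix : Set c
  Matrix = ℕ → ℕ → Carrier

  IsF0-1 : Series → Set ℓ
  IsF0-1 g = g 0 ≈ 1#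

  IsF1 : Series → Set ℓ
  IsF1 f = (f 0 ≈ 0#) × ¬ (f 1 ≈ 0#)

  -- coefficient [tⁿ] (t^m f)
  shiftCoeff : ℕ → Series → ℕ → Carrier
  shiftCoeff m f n with m ≤? n
  ... | yes _ = f (n ∸ m)
  ... | no  _ = 0#

  -- the quasi-Riordan array [g,f] = (g, f, t f, t² f, …)
  qr : Series → Series → Matrix
  qr g f n zero    = g n
  qr g f n (suc j) = shiftCoeff j f n

  IsQuasiRiordan : Matrix → Set (c ⊔ ℓ)
  IsQuasiRiordan M =
    Σ Series λ g → Σ Series λ f →
      IsF0-1 g × IsF1 f × (∀ n k → M n k ≈ qr g f n k)

  _≈M_ : Matrix → Matrix → Set ℓ
  A ≈M B = ∀ n k → A n k ≈ B n k

  sumTo : ℕ → (ℕ → Carrier) → Carrier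
  sumTo zero    a = a 0
  sumTo (suc n) a = sumTo n a + a (suc n)


  -- ordinary matrix product; for lower triangular matrices the sum
  -- Σ_k A n k * B k j has only the terms k ≤ n
  _·_ : Matrix → Matrix → Matrix
  (A · B) n j = sumTo n (λ k → A n k * B k j)

  identity : Matrix
  identity n k with n Data.Nat.≟ k
  ... | yes _ = 1#
  ... | no  _ = 0#

  record IsGroupUnderMul (S : Matrix → Set (c ⊔ ℓ)) : Set (c ⊔ ℓ) where
    field
      closed     : ∀ A B → S A → S B → S (A · B)
      assoc      : ∀ A B C → S A → S B → S C → ((A · B) · C) ≈M (A · (B · C))
      hasIdentity : S identity
      identityˡ  : ∀ A → S A → (identity · A) ≈M A
      identityʳ  : ∀ A → S A → (A · identity) ≈M A
      inverses   : ∀ A → S A → Σ Matrix λ B → S B × (A · B) ≈M identity × (B · A) ≈M identity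

{-# OPTIONS --safe #-}

-- A matrix is a quasi-Riordan array exactly when its (0,0) entry is 1, the rest of
-- row 0 vanishes, every column j+2 is column j+1 shifted down by one, and the
-- (1,1) entry is nonzero. These local conditions are stable under products
-- and hold for the identity. Lower triangular matrices multiply associatively, and
-- the left inverse of such a matrix can be solved for row by row: shifting forces
-- all but two entries of each row, and the (n,1) and (n,0) equations determine those
-- two, using the inverse of the (1,1) entry and the 1 in the corner. A left inverse
-- of a left inverse then makes it a two-sided inverse.
module Submission where

open import Defs
open import Data.Nat using (ℕ; zero; suc; _≤_; _<_; z≤n; s≤s; s≤s⁻¹; _∸_)
import Data.Nat as ℕ
open import Data.Nat.Properties
  using (_≤?_; ≤-refl; ≤-trans; m≤n⇒m≤1+n; m≤n⇒m<n∨m≡n; ≰⇒>; n<1+n; <-irrefl)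
open import Data.Product using (Σ; _×_; _,_; proj₁; proj₂)
open import Data.Sum using (inj₁; inj₂)
open import Data.Empty using (⊥-elim)
open import Relation.Nullary using (¬_; yes; no)
open import Relation.Binary.Bundles using (Setoid)
import Relation.Binary.PropositionalEquality as ≡
import Relation.Binary.Reasoning.Setoid as SetoidReasoning
import Algebra.Properties.CommutativeSemigroup as CommutativeSemigroupProperties

module LowerTriangularMatrices {c ℓ} (K : Field c ℓ) where
  open Field K
  open QuasiRiordan K
  open SetoidReasoning setoid
  open CommutativeSemigroupProperties +-commutativeSemigroup using (interchange)

  sumTo-cong≤ : ∀ n {a b : ℕ → Carrier} → (∀ k → k ≤ n → a k ≈ b k) → sumTo n a ≈ sumTo n b
  sumTo-cong≤ zero    a≈b = a≈b 0 z≤n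
  sumTo-cong≤ (suc n) a≈b = +-cong (sumTo-cong≤ n (λ k k≤n → a≈b k (m≤n⇒m≤1+n k≤n))) (a≈b (suc n) ≤-refl)

  sumTo-cong : ∀ n {a b : ℕ → Carrier} → (∀ k → a k ≈ b k) → sumTo n a ≈ sumTo n b
  sumTo-cong n a≈b = sumTo-cong≤ n (λ k _ → a≈b k)

  sumTo-sucˡ : ∀ n (a : ℕ → Carrier) → sumTo (suc n) a ≈ a 0 + sumTo n (λ k → a (suc k))
  sumTo-sucˡ zero    a = refl
  sumTo-sucˡ (suc n) a = trans (+-congʳ (sumTo-sucˡ n a)) (+-assoc _ _ _)

  sumTo-dropHead : ∀ n (a : ℕ → Carrier) → a 0 ≈ 0# → sumTo (suc n) a ≈ sumTo n (λ k → a (suc k))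
  sumTo-dropHead n a a0≈0 = trans (sumTo-sucˡ n a) (trans (+-congʳ a0≈0) (+-identityˡ _))

  sumTo-≈0 : ∀ n (a : ℕ → Carrier) → (∀ k → k ≤ n → a k ≈ 0#) → sumTo n a ≈ 0#
  sumTo-≈0 n a a≈0 = trans (sumTo-cong≤ n a≈0) (sumTo-0# n)
    where
    sumTo-0# : ∀ n → sumTo n (λ _ → 0#) ≈ 0#
    sumTo-0# zero    = refl
    sumTo-0# (suc n) = trans (+-congʳ (sumTo-0# n)) (+-identityˡ 0#)

  sumTo-+ : ∀ n (a b : ℕ → Carrier) → sumTo n (λ k → a k + b k) ≈ sumTo n a + sumTo n b
  sumTo-+ zero    a b = refl
  sumTo-+ (suc n) a b = trans (+-congʳ (sumTo-+ n a b)) (interchange _ _ _ _)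

  *-distribˡ-sumTo : ∀ n x (a : ℕ → Carrier) → x * sumTo n a ≈ sumTo n (λ k → x * a k)
  *-distribˡ-sumTo zero    x a = refl
  *-distribˡ-sumTo (suc n) x a = trans (distribˡ x _ _) (+-congʳ (*-distribˡ-sumTo n x a))

  *-distribʳ-sumTo : ∀ n x (a : ℕ → Carrier) → sumTo n a * x ≈ sumTo n (λ k → a k * x)
  *-distribʳ-sumTo zero    x a = refl
  *-distribʳ-sumTo (suc n) x a = trans (distribʳ x _ _) (+-congʳ (*-distribʳ-sumTo n x a))

  sumTo-comm : ∀ n m (a : ℕ → ℕ → Carrier) →
    sumTo n (λ i → sumTo m (a i)) ≈ sumTo m (λ j → sumTo n (λ i → a i j))
  sumTo-comm zero    m a = refl
  sumTo-comm (suc n) m a =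
    trans (+-congʳ (sumTo-comm n m a)) (sym (sumTo-+ m (λ j → sumTo n (λ i → a i j)) (a (suc n))))

  sumTo-truncate : ∀ {m} n (a : ℕ → Carrier) → m ≤ n → (∀ k → m < k → a k ≈ 0#) → sumTo n a ≈ sumTo m a
  sumTo-truncate zero        a z≤n _    = refl
  sumTo-truncate {m} (suc n) a m≤1+n a≈0 with m≤n⇒m<n∨m≡n m≤1+n
  ... | inj₂ ≡.refl   = refl
  ... | inj₁ (s≤s m≤n) =
    trans (+-cong (sumTo-truncate n a m≤n a≈0) (a≈0 (suc n) (s≤s m≤n))) (+-identityʳ _)

  identity-diag : ∀ n → identity n n ≈ 1#
  identity-diag n with n ℕ.≟ n
  ... | yes _  = refl
  ... | no n≢n = ⊥-elim (n≢n ≡.refl)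

  identity-off : ∀ n k → n ≡.≢ k → identity n k ≈ 0#
  identity-off n k n≢k with n ℕ.≟ k
  ... | yes n≡k = ⊥-elim (n≢k n≡k)
  ... | no  _   = refl

  identity-sym : ∀ n k → identity n k ≈ identity k n
  identity-sym n k with n ℕ.≟ k | k ℕ.≟ n
  ... | yes _   | yes _   = refl
  ... | no  _   | no  _   = refl
  ... | yes n≡k | no  k≢n = ⊥-elim (k≢n (≡.sym n≡k))
  ... | no  n≢k | yes k≡n = ⊥-elim (n≢k (≡.sym k≡n))

  identity-suc : ∀ n k → identity (suc n) (suc k) ≈ identity n k
  identity-suc n k with suc n ℕ.≟ suc k | n ℕ.≟ k
  ... | yes _   | yes _   = refl
  ... | no  _   | no  _   = refl
  ... | yes n≡k | no  n≢k = ⊥-elim (n≢k (≡.cong ℕ.pred n≡k))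
  ... | no  n≢k | yes n≡k = ⊥-elim (n≢k (≡.cong suc n≡k))

  sumTo-*identity-beyond : ∀ n j (a : ℕ → Carrier) → n < j → sumTo n (λ k → a k * identity k j) ≈ 0#
  sumTo-*identity-beyond n j a n<j = sumTo-≈0 n _ λ k k≤n →
    trans (*-congˡ (identity-off k j (λ k≡j → <-irrefl k≡j (≤-trans (s≤s k≤n) n<j)))) (zeroʳ _)

  sumTo-*identity : ∀ n j (a : ℕ → Carrier) → j ≤ n → sumTo n (λ k → a k * identity k j) ≈ a j
  sumTo-*identity zero    zero a z≤n = trans (*-congˡ (identity-diag 0)) (*-identityʳ _)
  sumTo-*identity (suc n) j    a j≤1+n with m≤n⇒m<n∨m≡n j≤1+n
  ... | inj₂ ≡.refl =
    trans (+-cong (sumTo-*identity-beyond n (suc n) a (n<1+n n)) (*-congˡ (identity-diag (suc n))))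
          (trans (+-identityˡ _) (*-identityʳ _))
  ... | inj₁ (s≤s j≤n) =
    trans (+-cong (sumTo-*identity n j a j≤n)
                  (trans (*-congˡ (identity-off (suc n) j (λ 1+n≡j → <-irrefl (≡.sym 1+n≡j) (s≤s j≤n)))) (zeroʳ _)))
          (+-identityʳ _)

  ≈M-setoid : Setoid c ℓ
  ≈M-setoid = record
    { Carrier       = Matrix
    ; _≈_           = _≈M_
    ; isEquivalence = record
      { refl  = λ _ _ → refl
      ; sym   = λ A≈B n k → sym (A≈B n k)
      ; trans = λ A≈B B≈C n k → trans (A≈B n k) (B≈C n k)
      }
    }

  ·-cong : ∀ {A A′ B B′} → A ≈M A′ → B ≈M B′ → (A · B) ≈M (A′ · B′)
  ·-cong A≈A′ B≈B′ n j = sumTo-cong n (λ k → *-cong (A≈A′ n k) (B≈B′ k j))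

  LowerTriangular : Matrix → Set ℓ
  LowerTriangular A = ∀ n k → n < k → A n k ≈ 0#

  ·-assoc : ∀ A B C → LowerTriangular B → ((A · B) · C) ≈M (A · (B · C))
  ·-assoc A B C B-lower n j = begin
    sumTo n (λ k → sumTo n (λ m → A n m * B m k) * C k j)
      ≈⟨ sumTo-cong n (λ k → *-distribʳ-sumTo n (C k j) (λ m → A n m * B m k)) ⟩
    sumTo n (λ k → sumTo n (λ m → (A n m * B m k) * C k j))
      ≈⟨ sumTo-comm n n (λ k m → (A n m * B m k) * C k j) ⟩
    sumTo n (λ m → sumTo n (λ k → (A n m * B m k) * C k j))
      ≈⟨ sumTo-cong≤ n inner ⟩
    sumTo n (λ m → A n m * sumTo m (λ k → B m k * C k j)) ∎
    where
    inner : ∀ m → m ≤ n →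
      sumTo n (λ k → (A n m * B m k) * C k j) ≈ A n m * sumTo m (λ k → B m k * C k j)
    inner m m≤n = begin
      sumTo n (λ k → (A n m * B m k) * C k j) ≈⟨ sumTo-cong n (λ k → *-assoc _ _ _) ⟩
      sumTo n (λ k → A n m * (B m k * C k j)) ≈⟨ sym (*-distribˡ-sumTo n (A n m) _) ⟩
      A n m * sumTo n (λ k → B m k * C k j)   ≈⟨ *-congˡ (sumTo-truncate n _ m≤n
                                                    (λ k m<k → trans (*-congʳ (B-lower m k m<k)) (zeroˡ _))) ⟩
      A n m * sumTo m (λ k → B m k * C k j)   ∎

  ·-identityˡ : ∀ A → (identity · A) ≈M A
  ·-identityˡ A n j = trans (sumTo-cong n (λ k → trans (*-comm _ _) (*-congˡ (identity-sym n k))))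
                            (sumTo-*identity n n (λ k → A k j) ≤-refl)

  ·-identityʳ : ∀ A → LowerTriangular A → (A · identity) ≈M A
  ·-identityʳ A A-lower n j with j ≤? n
  ... | yes j≤n = sumTo-*identity n j (A n) j≤n
  ... | no  j≰n = trans (sumTo-*identity-beyond n j (A n) (≰⇒> j≰n)) (sym (A-lower n j (≰⇒> j≰n)))

module TwoSidedInverses {c ℓ} (K : Field c ℓ) where
  open QuasiRiordan K
  open LowerTriangularMatrices K
  open Setoid ≈M-setoid using (refl; sym)
  open SetoidReasoning ≈M-setoid

  leftInverse-isRightInverse : ∀ {A B C} → LowerTriangular A → LowerTriangular B →
    (B · A) ≈M identity → (C · B) ≈M identity → (A · B) ≈M identity
  leftInverse-isRightInverse {A} {B} {C} A-lower B-lower BA≈I CB≈I = begin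
    A · B                 ≈⟨ sym (·-identityˡ (A · B)) ⟩
    identity · (A · B)    ≈⟨ ·-cong (sym CB≈I) refl ⟩
    (C · B) · (A · B)     ≈⟨ ·-assoc C B (A · B) B-lower ⟩
    C · (B · (A · B))     ≈⟨ ·-cong {C} refl (sym (·-assoc B A B A-lower)) ⟩
    C · ((B · A) · B)     ≈⟨ ·-cong {C} refl (·-cong BA≈I refl) ⟩
    C · (identity · B)    ≈⟨ ·-cong {C} refl (·-identityˡ B) ⟩
    C · B                 ≈⟨ CB≈I ⟩
    identity              ∎

module QuasiRiordanGroup {c ℓ} (K : Field c ℓ) where
  open Field K
  open QuasiRiordan K
  open LowerTriangularMatrices K
  open TwoSidedInverses K
  open SetoidReasoning setoid

  *-≉0 : ∀ {x y} → ¬ (x ≈ 0#) → ¬ (y ≈ 0#) → ¬ (x * y ≈ 0#)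
  *-≉0 {x} {y} x≉0 y≉0 xy≈0 with inverse x x≉0
  ... | x⁻¹ , xx⁻¹≈1 = y≉0 (begin
    y                ≈⟨ sym (*-identityˡ y) ⟩
    1# * y           ≈⟨ *-congʳ (trans (sym xx⁻¹≈1) (*-comm x x⁻¹)) ⟩
    (x⁻¹ * x) * y    ≈⟨ *-assoc x⁻¹ x y ⟩
    x⁻¹ * (x * y)    ≈⟨ *-congˡ xy≈0 ⟩
    x⁻¹ * 0#         ≈⟨ zeroʳ x⁻¹ ⟩
    0#               ∎)

  TopRowVanishes : Matrix → Set ℓ
  TopRowVanishes A = ∀ j → A 0 (suc j) ≈ 0#

  ColumnsShift : Matrix → Set ℓ
  ColumnsShift A = ∀ n j → A (suc n) (suc (suc j)) ≈ A n (suc j)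

  record QRShape (A : Matrix) : Set ℓ where
    field
      corner  : A 0 0 ≈ 1#
      topRow  : TopRowVanishes A
      shift   : ColumnsShift A
      pivot   : ¬ (A 1 1 ≈ 0#)
  open QRShape

  shape-lowerTriangular : ∀ {A} → TopRowVanishes A → ColumnsShift A → LowerTriangular A
  shape-lowerTriangular {A} top sh n       zero          ()
  shape-lowerTriangular {A} top sh zero    (suc j)       _         = top j
  shape-lowerTriangular {A} top sh (suc n) (suc zero)    (s≤s ())
  shape-lowerTriangular {A} top sh (suc n) (suc (suc j)) (s≤s n<j) =
    trans (sh n j) (shape-lowerTriangular {A} top sh n (suc j) n<j)

  QRShape-lowerTriangular : ∀ {A} → QRShape A → LowerTriangular A
  QRShape-lowerTriangular sA = shape-lowerTriangular (topRow sA) (shift sA)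

  ≈M-fromFirstColumns : ∀ {M N} → TopRowVanishes M → ColumnsShift M → TopRowVanishes N → ColumnsShift N →
    (∀ n → M n 0 ≈ N n 0) → (∀ n → M n 1 ≈ N n 1) → M ≈M N
  ≈M-fromFirstColumns {M} {N} topM shM topN shN col0 col1 = go
    where
    go : M ≈M N
    go n       zero          = col0 n
    go n       (suc zero)    = col1 n
    go zero    (suc (suc j)) = trans (topM (suc j)) (sym (topN (suc j)))
    go (suc n) (suc (suc j)) = trans (shM n j) (trans (go n (suc j)) (sym (shN n j)))

  ·-topRow : ∀ A B → TopRowVanishes B → TopRowVanishes (A · B)
  ·-topRow A B topB j = trans (*-congˡ (topB j)) (zeroʳ _)

  ·-shift : ∀ A B → ColumnsShift A → TopRowVanishes B → ColumnsShift B → ColumnsShift (A · B)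
  ·-shift A B shA topB shB n j = begin
    (A · B) (suc n) (suc (suc j))
      ≈⟨ sumTo-dropHead n _ (times0 (topB (suc j))) ⟩
    sumTo n (λ k → A (suc n) (suc k) * B (suc k) (suc (suc j)))
      ≈⟨ shifted n ⟩
    sumTo n (λ k → A n k * B k (suc j))
      ∎
    where
    times0 : ∀ {x y} → y ≈ 0# → x * y ≈ 0#
    times0 y≈0 = trans (*-congˡ y≈0) (zeroʳ _)
    B1≈0 : B 1 (suc (suc j)) ≈ 0#
    B1≈0 = trans (shB 0 j) (topB j)
    shifted : ∀ n → sumTo n (λ k → A (suc n) (suc k) * B (suc k) (suc (suc j))) ≈ sumTo n (λ k → A n k * B k (suc j))
    shifted zero    = trans (times0 B1≈0) (sym (times0 (topB j)))
    shifted (suc m) = begin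
      sumTo (suc m) (λ k → A (suc (suc m)) (suc k) * B (suc k) (suc (suc j)))
        ≈⟨ sumTo-dropHead m _ (times0 B1≈0) ⟩
      sumTo m (λ k → A (suc (suc m)) (suc (suc k)) * B (suc (suc k)) (suc (suc j)))
        ≈⟨ sumTo-cong m (λ k → *-cong (shA (suc m) k) (shB (suc k) j)) ⟩
      sumTo m (λ k → A (suc m) (suc k) * B (suc k) (suc j))
        ≈⟨ sym (sumTo-dropHead m _ (times0 (topB j))) ⟩
      sumTo (suc m) (λ k → A (suc m) k * B k (suc j))
        ∎

  ·-QRShape : ∀ {A B} → QRShape A → QRShape B → QRShape (A · B)
  ·-QRShape {A} {B} sA sB = record
    { corner = trans (*-cong (corner sA) (corner sB)) (*-identityˡ 1#)
    ; topRow = ·-topRow A B (topRow sB)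
    ; shift  = ·-shift A B (shift sA) (topRow sB) (shift sB)
    ; pivot  = λ AB₁₁≈0 → *-≉0 (pivot sA) (pivot sB) (trans (sym AB₁₁≈A₁₁B₁₁) AB₁₁≈0)
    }
    where
    AB₁₁≈A₁₁B₁₁ : (A · B) 1 1 ≈ A 1 1 * B 1 1
    AB₁₁≈A₁₁B₁₁ = sumTo-dropHead 0 (λ k → A 1 k * B k 1) (trans (*-congˡ (topRow sB 0)) (zeroʳ _))

  identity-QRShape : QRShape identity
  identity-QRShape = record
    { corner = identity-diag 0
    ; topRow = λ j → identity-off 0 (suc j) (λ ())
    ; shift  = λ n j → identity-suc n (suc j)
    ; pivot  = λ I₁₁≈0 → 1≉0 (trans (sym (identity-diag 1)) I₁₁≈0)
    }

  shiftCoeff-≤ : ∀ j n f → j ≤ n → shiftCoeff j f n ≈ f (n ∸ j)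
  shiftCoeff-≤ j n f j≤n with j ≤? n
  ... | yes _   = refl
  ... | no  j≰n = ⊥-elim (j≰n j≤n)

  shiftCoeff-≰ : ∀ j n f → ¬ (j ≤ n) → shiftCoeff j f n ≈ 0#
  shiftCoeff-≰ j n f j≰n with j ≤? n
  ... | yes j≤n = ⊥-elim (j≰n j≤n)
  ... | no  _   = refl

  shiftCoeff-suc : ∀ j n f → shiftCoeff (suc j) f (suc n) ≈ shiftCoeff j f n
  shiftCoeff-suc j n f with j ≤? n
  ... | yes j≤n = shiftCoeff-≤ (suc j) (suc n) f (s≤s j≤n)
  ... | no  j≰n = shiftCoeff-≰ (suc j) (suc n) f (λ 1+j≤1+n → j≰n (s≤s⁻¹ 1+j≤1+n))

  QRShape⇒IsQuasiRiordan : ∀ {A} → QRShape A → IsQuasiRiordan A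
  QRShape⇒IsQuasiRiordan {A} sA = g , f , corner sA , (topRow sA 0 , pivot sA) , A≈qr
    where
    g f : Series
    g n = A n 0
    f n = A n 1
    column : ∀ n j → A n (suc j) ≈ shiftCoeff j f n
    column n       zero    = sym (shiftCoeff-≤ 0 n f z≤n)
    column zero    (suc j) = trans (topRow sA (suc j)) (sym (shiftCoeff-≰ (suc j) 0 f (λ ())))
    column (suc n) (suc j) = trans (shift sA n j) (trans (column n j) (sym (shiftCoeff-suc j n f)))
    A≈qr : ∀ n k → A n k ≈ qr g f n k
    A≈qr n zero    = refl
    A≈qr n (suc j) = column n j

  IsQuasiRiordan⇒QRShape : ∀ {A} → IsQuasiRiordan A → QRShape A
  IsQuasiRiordan⇒QRShape {A} (g , f , g₀≈1 , (f₀≈0 , f₁≉0) , A≈qr) = record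
    { corner = trans (A≈qr 0 0) g₀≈1
    ; topRow = λ j → trans (A≈qr 0 (suc j)) (shiftCoeff-at0 j)
    ; shift  = λ n j → trans (A≈qr (suc n) (suc (suc j))) (trans (shiftCoeff-suc j n f) (sym (A≈qr n (suc j))))
    ; pivot  = λ A₁₁≈0 → f₁≉0 (trans (sym (shiftCoeff-≤ 0 1 f z≤n)) (trans (sym (A≈qr 1 1)) A₁₁≈0))
    }
    where
    shiftCoeff-at0 : ∀ j → shiftCoeff j f 0 ≈ 0#
    shiftCoeff-at0 zero    = trans (shiftCoeff-≤ 0 0 f z≤n) f₀≈0
    shiftCoeff-at0 (suc j) = shiftCoeff-≰ (suc j) 0 f (λ ())

  module LeftInverse {A : Matrix} (sA : QRShape A) where

    pivot⁻¹ : Carrier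
    pivot⁻¹ = proj₁ (inverse (A 1 1) (pivot sA))

    pivot⁻¹-inverse : pivot⁻¹ * A 1 1 ≈ 1#
    pivot⁻¹-inverse = trans (*-comm _ _) (proj₂ (inverse (A 1 1) (pivot sA)))

    -- tail m b c = Σ_{k<m} b (k+1) * A (k+2) c, the part of (B·A)(m+1) c fixed by row m of B
    tail : ℕ → (ℕ → Carrier) → ℕ → Carrier
    tail zero    b c = 0#
    tail (suc m) b c = sumTo m (λ k → b (suc k) * A (suc (suc k)) c)

    mutual
      B₁ : ℕ → Carrier
      B₁ m = (identity m 0 + - tail m (B m) 1) * pivot⁻¹

      B : Matrix
      B zero    zero          = 1#
      B zero    (suc j)       = 0#
      B (suc m) zero          = - (B₁ m * A 1 0 + tail m (B m) 0)
      B (suc m) (suc zero)    = B₁ m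
      B (suc m) (suc (suc j)) = B m (suc j)

    rest : ℕ → ℕ → Carrier
    rest m c = B₁ m * A 1 c + tail m (B m) c

    B·A-suc : ∀ m c → (B · A) (suc m) c ≈ B (suc m) 0 * A 0 c + rest m c
    B·A-suc m c = trans (sumTo-sucˡ m _) (+-congˡ (columnsFrom1 m))
      where
      columnsFrom1 : ∀ m → sumTo m (λ k → B (suc m) (suc k) * A (suc k) c) ≈ rest m c
      columnsFrom1 zero    = sym (+-identityʳ _)
      columnsFrom1 (suc m) = sumTo-sucˡ m _

    B·A-column0 : ∀ n → (B · A) n 0 ≈ identity n 0
    B·A-column0 zero    = trans (*-identityˡ _) (trans (corner sA) (sym (identity-diag 0)))
    B·A-column0 (suc m) = begin
      (B · A) (suc m) 0              ≈⟨ B·A-suc m 0 ⟩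
      - rest m 0 * A 0 0 + rest m 0  ≈⟨ +-congʳ (trans (*-congˡ (corner sA)) (*-identityʳ _)) ⟩
      - rest m 0 + rest m 0          ≈⟨ -‿inverseˡ _ ⟩
      0#                             ≈⟨ sym (identity-off (suc m) 0 (λ ())) ⟩
      identity (suc m) 0             ∎

    B·A-column1 : ∀ n → (B · A) n 1 ≈ identity n 1
    B·A-column1 zero    = trans (*-identityˡ _) (trans (topRow sA 0) (sym (identity-off 0 1 (λ ()))))
    B·A-column1 (suc m) = begin
      (B · A) (suc m) 1                          ≈⟨ B·A-suc m 1 ⟩
      B (suc m) 0 * A 0 1 + rest m 1             ≈⟨ +-congʳ (trans (*-congˡ (topRow sA 0)) (zeroʳ _)) ⟩
      0# + rest m 1                              ≈⟨ +-identityˡ _ ⟩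
      ((δ + - u) * pivot⁻¹) * A 1 1 + u          ≈⟨ +-congʳ (trans (*-assoc _ _ _)
                                                      (trans (*-congˡ pivot⁻¹-inverse) (*-identityʳ _))) ⟩
      (δ + - u) + u                              ≈⟨ +-assoc _ _ _ ⟩
      δ + (- u + u)                              ≈⟨ +-congˡ (-‿inverseˡ u) ⟩
      δ + 0#                                     ≈⟨ +-identityʳ _ ⟩
      identity m 0                               ≈⟨ sym (identity-suc m 0) ⟩
      identity (suc m) 1                         ∎
      where
      δ u : Carrier
      δ = identity m 0
      u = tail m (B m) 1

    B·A≈identity : (B · A) ≈M identity
    B·A≈identity =
      ≈M-fromFirstColumns (·-topRow B A (topRow sA)) (·-shift B A (λ _ _ → refl) (topRow sA) (shift sA))
                          (topRow identity-QRShape) (shift identity-QRShape)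
                          B·A-column0 B·A-column1

    B-QRShape : QRShape B
    B-QRShape = record
      { corner = refl
      ; topRow = λ _ → refl
      ; shift  = λ _ _ → refl
      ; pivot  = λ B₁₁≈0 → 1≉0 (begin
          1#                              ≈⟨ sym (identity-diag 1) ⟩
          identity 1 1                    ≈⟨ sym (B·A≈identity 1 1) ⟩
          B 1 0 * A 0 1 + B 1 1 * A 1 1   ≈⟨ +-cong (trans (*-congˡ (topRow sA 0)) (zeroʳ _))
                                                     (trans (*-congʳ B₁₁≈0) (zeroˡ _)) ⟩
          0# + 0#                         ≈⟨ +-identityˡ 0# ⟩
          0#                              ∎)
      }

  QRShape-inverse : ∀ {A} → QRShape A →
    Σ Matrix λ B → QRShape B × (A · B) ≈M identity × (B · A) ≈M identity
  QRShape-inverse {A} sA = B , sB , A·B≈identity , L.B·A≈identity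
    where
    module L = LeftInverse sA
    B : Matrix
    B = L.B
    sB : QRShape B
    sB = L.B-QRShape
    A·B≈identity : (A · B) ≈M identity
    A·B≈identity = leftInverse-isRightInverse (QRShape-lowerTriangular sA) (QRShape-lowerTriangular sB)
                     L.B·A≈identity (LeftInverse.B·A≈identity sB)

  isGroupUnderMul : IsGroupUnderMul IsQuasiRiordan
  isGroupUnderMul = record
    { closed      = λ A B a b → QRShape⇒IsQuasiRiordan (·-QRShape (shape a) (shape b))
    ; assoc       = λ A B C _ b _ → ·-assoc A B C (QRShape-lowerTriangular (shape b))
    ; hasIdentity = QRShape⇒IsQuasiRiordan identity-QRShape
    ; identityˡ   = λ A _ → ·-identityˡ A
    ; identityʳ   = λ A a → ·-identityʳ A (QRShape-lowerTriangular (shape a))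
    ; inverses    = λ A a → let B , sB , AB≈I , BA≈I = QRShape-inverse (shape a)
                            in B , QRShape⇒IsQuasiRiordan sB , AB≈I , BA≈I
    }
    where
    shape : ∀ {A} → IsQuasiRiordan A → QRShape A
    shape = IsQuasiRiordan⇒QRShape

theorem3p2 : ∀ {c ℓ} (K : Field c ℓ) →
    QuasiRiordan.IsGroupUnderMul K (QuasiRiordan.IsQuasiRiordan K)
theorem3p2 K = QuasiRiordanGroup.isGroupUnderMul K
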